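{- Let $G$ be a Klee-graph. For every $v\in V(G)$ there exists a $v$-join of $G$.
   Context: For a cubic graph $G$ and $v\in V(G)$ with neighbours $x_1,x_2,x_3$, $G^v$ is obtained by replacing $v$ with a triangle: delete $v$, add new vertices $v_1,v_2,v_3$, the edges $v_ix_i$ ($i=1,2,3$) and $v_1v_2,v_2v_3,v_3v_1$. Klee-graphs are defined recursively: $K_4$ is a Klee-graph, and if $H$ is a Klee-graph and $w\in V(H)$ then $H^w$ is a Klee-graph. For a cubic graph $G$ and $v\in V(G)$, a $v$-join of $G$ is a spanning subgraph in which $v$ has degree $3$ and every other vertex has degree $1$. -}

module Defs where

open import Data.Nat using (ℕ; zero; suc; _+_)
open import Data.Fin using (Fin; zero; suc; _≟_)
open import Data.Bool using (Bool; true; false; not; _∨_; _∧_; if_then_else_)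
open import Data.List using (List; map; allFin)
open import Data.Nat.ListAction using (sum)
open import Relation.Nullary.Decidable using (⌊_⌋)
open import Relation.Binary.PropositionalEquality using (_≡_; _≢_)
open import Function.Bundles using (_↔_; Inverse)
open import Data.Product using (Σ; _×_)
open import Data.Sum using (_⊎_)

-- Symmetry/irreflexivity are not stored here;
-- all concretely constructed graphs below satisfy them.
record Graph : Set where
  constructor mkGraph
  field
    n   : ℕ
    adj : Fin n → Fin n → Bool

open Graph public

Vertex : Graph → Set
Vertex G = Fin (n G)

_==_ : {m : ℕ} → Fin m → Fin m → Bool
i == j = ⌊ i ≟ j ⌋

countTrue : {m : ℕ} → (Fin m → Bool) → ℕ
countTrue {m} f = sum (map (λ j → if f j then 1 else 0) (allFin m))

K4 : Graph
K4 = mkGraph 4 (λ i j → not (i == j))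

-- Triangle replacement G^w, where x₁ x₂ x₃ are the (three distinct)
-- neighbours of w.  Vertices of G^w: Fin (2 + n G); old vertex i becomes
-- suc (suc i) (w itself becomes v₁), and the new vertices v₂ = 0, v₃ = 1.
-- Edges: v₁x₁, v₂x₂, v₃x₃, the triangle v₁v₂v₃, and all edges of G not at w.
replaceAdj : (G : Graph) (w x₁ x₂ x₃ : Vertex G) →
             Fin (2 + n G) → Fin (2 + n G) → Bool
replaceAdj G w x₁ x₂ x₃ zero zero = false
replaceAdj G w x₁ x₂ x₃ zero (suc zero) = true
replaceAdj G w x₁ x₂ x₃ (suc zero) zero = true
replaceAdj G w x₁ x₂ x₃ (suc zero) (suc zero) = false
replaceAdj G w x₁ x₂ x₃ zero (suc (suc j)) = (j == w) ∨ (j == x₂)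
replaceAdj G w x₁ x₂ x₃ (suc (suc i)) zero = (i == w) ∨ (i == x₂)
replaceAdj G w x₁ x₂ x₃ (suc zero) (suc (suc j)) = (j == w) ∨ (j == x₃)
replaceAdj G w x₁ x₂ x₃ (suc (suc i)) (suc zero) = (i == w) ∨ (i == x₃)
replaceAdj G w x₁ x₂ x₃ (suc (suc i)) (suc (suc j)) =
  if i == w then j == x₁
  else (if j == w then i == x₁ else adj G i j)

replace : (G : Graph) (w x₁ x₂ x₃ : Vertex G) → Graph
replace G w x₁ x₂ x₃ = mkGraph (2 + n G) (replaceAdj G w x₁ x₂ x₃)

_≅_ : Graph → Graph → Set
G ≅ H = Σ (Vertex G ↔ Vertex H) λ f →
          ∀ i j → adj G i j ≡ adj H (Inverse.to f i) (Inverse.to f j)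

NeighboursOf : (G : Graph) → Vertex G → (x₁ x₂ x₃ : Vertex G) → Set
NeighboursOf G w x₁ x₂ x₃ =
  (adj G w x₁ ≡ true × adj G w x₂ ≡ true × adj G w x₃ ≡ true) ×
  (x₁ ≢ x₂ × x₁ ≢ x₃ × x₂ ≢ x₃) ×
  (∀ y → adj G w y ≡ true → (y ≡ x₁ ⊎ y ≡ x₂ ⊎ y ≡ x₃))

-- Klee-graphs (closed under isomorphism, as graphs are considered up to
-- isomorphism).
data IsKlee : Graph → Set where
  k4      : IsKlee K4
  expand  : ∀ {H} → IsKlee H → (w x₁ x₂ x₃ : Vertex H) →
            NeighboursOf H w x₁ x₂ x₃ → IsKlee (replace H w x₁ x₂ x₃)
  isoKlee : ∀ {G H} → IsKlee G → G ≅ H → IsKlee H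

record SpanningSubgraph (G : Graph) : Set where
  field
    edge    : Vertex G → Vertex G → Bool
    sub     : ∀ i j → edge i j ≡ true → adj G i j ≡ true
    edgeSym : ∀ i j → edge i j ≡ edge j i

open SpanningSubgraph public

degreeIn : {G : Graph} → SpanningSubgraph G → Vertex G → ℕ
degreeIn S i = countTrue (edge S i)

IsJoin : (G : Graph) → Vertex G → SpanningSubgraph G → Set
IsJoin G v S = degreeIn S v ≡ 3 × (∀ u → u ≢ v → degreeIn S u ≡ 1)

-- Strengthen the claim to "every vertex has a join and every edge lies in a perfect matching"
-- and induct on the construction of G; isomorphisms transport both properties. In H^w, a
-- subgraph of H in which w has the single edge w xᵢ lifts with all degrees kept: move w xᵢ to
-- vᵢ xᵢ and add the triangle edge opposite vᵢ. This lifts joins at old vertices, and perfect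
-- matchings through every edge. A join at a triangle vertex vᵢ is a lifted perfect matching of H
-- through w xᵢ together with both triangle edges at vᵢ, which is why the matchings are needed.
module Submission where

open import Defs
open import Data.Bool using (Bool; true; false; not; _∨_; _∧_; _xor_; if_then_else_)
open import Data.Bool.Properties using (∨-identityʳ; ∧-conicalˡ; ¬-not) renaming (_≟_ to _≟ᴮ_)
open import Data.Empty using (⊥-elim)
open import Data.Fin using (Fin; zero; suc; _≟_; punchIn)
open import Data.Fin.Properties using (all?; punchInᵢ≢i)
open import Data.List using (tabulate)
open import Data.List.Properties using (map-tabulate)
open import Data.Nat using (ℕ; zero; suc; _+_; _≤_; z≤n; s≤s)
import Data.Nat as ℕ
open import Data.Nat.ListAction using (sum)
open import Data.Nat.Properties
  using (+-mono-≤; +-identityʳ; +-assoc; +-cancelˡ-≡; <-irrefl;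
         +-0-commutativeMonoid; +-commutativeSemigroup)
open import Data.Product using (Σ; _×_; _,_; proj₁; proj₂)
open import Data.Sum using (_⊎_; inj₁; inj₂)
open import Function using (_∘_)
open import Function.Bundles using (_↔_; Inverse)
open import Function.Construct.Symmetry using (↔-sym)
open import Relation.Nullary using (Dec; yes; no; ¬?)
open import Relation.Nullary.Decidable using (toWitness; _×-dec_; _→-dec_)
open import Relation.Binary.PropositionalEquality
  using (_≡_; _≢_; _≗_; refl; sym; trans; cong; cong₂; subst₂; module ≡-Reasoning)
open import Algebra.Properties.CommutativeSemigroup +-commutativeSemigroup
  using (x∙yz≈y∙xz; x∙yz≈z∙yx; x∙yz≈x∙zy)
open import Algebra.Properties.CommutativeMonoid.Sum +-0-commutativeMonoid
  using (sum-cong-≗; sum-remove; sum-permute; ∑-distrib-+)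
  renaming (sum to ∑)

⟦_⟧ : Bool → ℕ
⟦ b ⟧ = if b then 1 else 0

==-refl : ∀ {m} (i : Fin m) → (i == i) ≡ true
==-refl i with i ≟ i
... | yes _ = refl
... | no i≢i = ⊥-elim (i≢i refl)

≢⇒==-false : ∀ {m} {i j : Fin m} → i ≢ j → (i == j) ≡ false
≢⇒==-false {i = i} {j} i≢j with i ≟ j
... | yes i≡j = ⊥-elim (i≢j i≡j)
... | no _ = refl

==⇒≡ : ∀ {m} {i j : Fin m} → (i == j) ≡ true → i ≡ j
==⇒≡ {i = i} {j} eq with i ≟ j
... | yes i≡j = i≡j

single : ∀ {m} → Fin m → Bool → Fin m → Bool
single a p j = (j == a) ∧ p

single-here : ∀ {m} (a : Fin m) p → single a p a ≡ p
single-here a p rewrite ==-refl a = refl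

single-elsewhere : ∀ {m} {a j : Fin m} p → j ≢ a → single a p j ≡ false
single-elsewhere p j≢a rewrite ≢⇒==-false j≢a = refl

single-disjoint : ∀ {m} {a b : Fin m} {p q} j → a ≢ b →
                  single a p j ≡ true → single b q j ≡ false
single-disjoint {a = a} {p = p} j a≢b eq
  rewrite ==⇒≡ {i = j} (∧-conicalˡ (j == a) p eq) = single-elsewhere _ a≢b

⟦∨⟧ : ∀ {p q} → (p ≡ true → q ≡ false) → ⟦ p ∨ q ⟧ ≡ ⟦ p ⟧ + ⟦ q ⟧
⟦∨⟧ {true} p⇒¬q rewrite p⇒¬q refl = refl
⟦∨⟧ {false} _ = refl

∨-∧-conicalˡ : ∀ a b c d → ((a ∧ b) ∨ (c ∧ d)) ≡ true → (a ∨ c) ≡ true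
∨-∧-conicalˡ true _ _ _ _ = refl
∨-∧-conicalˡ false _ c d eq = ∧-conicalˡ c d eq

⟦⟧-mono : ∀ {p q} → (p ≡ true → q ≡ true) → ⟦ p ⟧ ≤ ⟦ q ⟧
⟦⟧-mono {true} p⇒q rewrite p⇒q refl = s≤s z≤n
⟦⟧-mono {false} _ = z≤n

countTrue≡∑ : ∀ {m} (f : Fin m → Bool) → countTrue f ≡ ∑ (⟦_⟧ ∘ f)
countTrue≡∑ f = trans (cong sum (map-tabulate (λ j → j) (⟦_⟧ ∘ f))) (sum-tabulate (⟦_⟧ ∘ f))
  where
  sum-tabulate : ∀ {k} (t : Fin k → ℕ) → sum (tabulate t) ≡ ∑ t
  sum-tabulate {zero} t = refl
  sum-tabulate {suc k} t = cong (t zero +_) (sum-tabulate (t ∘ suc))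

countTrue-suc : ∀ {m} (f : Fin (suc m) → Bool) → countTrue f ≡ ⟦ f zero ⟧ + countTrue (f ∘ suc)
countTrue-suc f = trans (countTrue≡∑ f) (cong (⟦ f zero ⟧ +_) (sym (countTrue≡∑ (f ∘ suc))))

countTrue-cong : ∀ {m} {f g : Fin m → Bool} → f ≗ g → countTrue f ≡ countTrue g
countTrue-cong {f = f} {g} f≗g = begin
  countTrue f      ≡⟨ countTrue≡∑ f ⟩
  ∑ (⟦_⟧ ∘ f)      ≡⟨ sum-cong-≗ (cong ⟦_⟧ ∘ f≗g) ⟩
  ∑ (⟦_⟧ ∘ g)      ≡⟨ countTrue≡∑ g ⟨
  countTrue g      ∎
  where open ≡-Reasoning

countTrue-∘↔ : ∀ {m n} (π : Fin m ↔ Fin n) (g : Fin n → Bool) →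
               countTrue (g ∘ Inverse.to π) ≡ countTrue g
countTrue-∘↔ π g = begin
  countTrue (g ∘ Inverse.to π)   ≡⟨ countTrue≡∑ (g ∘ Inverse.to π) ⟩
  ∑ (⟦_⟧ ∘ g ∘ Inverse.to π)     ≡⟨ sum-permute (⟦_⟧ ∘ g) π ⟨
  ∑ (⟦_⟧ ∘ g)                    ≡⟨ countTrue≡∑ g ⟨
  countTrue g                    ∎
  where open ≡-Reasoning

countTrue-∨ : ∀ {m} {f g : Fin m → Bool} → (∀ j → f j ≡ true → g j ≡ false) →
              countTrue (λ j → f j ∨ g j) ≡ countTrue f + countTrue g
countTrue-∨ {f = f} {g} disjoint = begin
  countTrue (λ j → f j ∨ g j)     ≡⟨ countTrue≡∑ (λ j → f j ∨ g j) ⟩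
  ∑ (λ j → ⟦ f j ∨ g j ⟧)         ≡⟨ sum-cong-≗ (λ j → ⟦∨⟧ (disjoint j)) ⟩
  ∑ (λ j → ⟦ f j ⟧ + ⟦ g j ⟧)     ≡⟨ ∑-distrib-+ (⟦_⟧ ∘ f) (⟦_⟧ ∘ g) ⟩
  ∑ (⟦_⟧ ∘ f) + ∑ (⟦_⟧ ∘ g)       ≡⟨ cong₂ _+_ (countTrue≡∑ f) (countTrue≡∑ g) ⟨
  countTrue f + countTrue g       ∎
  where open ≡-Reasoning

countTrue-remove : ∀ {m} (f : Fin (suc m) → Bool) (a : Fin (suc m)) →
                   countTrue f ≡ ⟦ f a ⟧ + countTrue (f ∘ punchIn a)
countTrue-remove f a = begin
  countTrue f                            ≡⟨ countTrue≡∑ f ⟩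
  ∑ (⟦_⟧ ∘ f)                            ≡⟨ sum-remove (⟦_⟧ ∘ f) ⟩
  ⟦ f a ⟧ + ∑ (⟦_⟧ ∘ f ∘ punchIn a)      ≡⟨ cong (⟦ f a ⟧ +_) (countTrue≡∑ (f ∘ punchIn a)) ⟨
  ⟦ f a ⟧ + countTrue (f ∘ punchIn a)    ∎
  where open ≡-Reasoning

countTrue-false : ∀ m → countTrue {m} (λ _ → false) ≡ 0
countTrue-false zero = refl
countTrue-false (suc m) = trans (countTrue-suc {m} (λ _ → false)) (countTrue-false m)

countTrue-single : ∀ {m} (a : Fin m) p → countTrue (single a p) ≡ ⟦ p ⟧
countTrue-single {suc m} a p = begin
  countTrue (single a p)
    ≡⟨ countTrue-remove (single a p) a ⟩
  ⟦ single a p a ⟧ + countTrue (single a p ∘ punchIn a)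
    ≡⟨ cong₂ _+_ (cong ⟦_⟧ (single-here a p)) elsewhere ⟩
  ⟦ p ⟧ + 0
    ≡⟨ +-identityʳ ⟦ p ⟧ ⟩
  ⟦ p ⟧
    ∎
  where
  open ≡-Reasoning
  elsewhere : countTrue (single a p ∘ punchIn a) ≡ 0
  elsewhere = trans (countTrue-cong (λ k → single-elsewhere p (punchInᵢ≢i a k))) (countTrue-false m)

countTrue-single₂ : ∀ {m} {a b : Fin m} p q → a ≢ b →
                    countTrue (λ j → single a p j ∨ single b q j) ≡ ⟦ p ⟧ + ⟦ q ⟧
countTrue-single₂ {a = a} {b} p q a≢b =
  trans (countTrue-∨ (λ j → single-disjoint j a≢b))
        (cong₂ _+_ (countTrue-single a p) (countTrue-single b q))

countTrue-mono : ∀ {m} {f g : Fin m → Bool} → (∀ j → f j ≡ true → g j ≡ true) →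
                 countTrue f ≤ countTrue g
countTrue-mono {zero} _ = z≤n
countTrue-mono {suc m} {f} {g} f⇒g
  rewrite countTrue-suc f | countTrue-suc g =
  +-mono-≤ (⟦⟧-mono (f⇒g zero)) (countTrue-mono (f⇒g ∘ suc))

countTrue≡1-unique : ∀ {m} {f : Fin m → Bool} {a b} → countTrue f ≡ 1 →
                     f a ≡ true → f b ≡ true → a ≡ b
countTrue≡1-unique {f = f} {a} {b} one fa fb with a ≟ b
... | yes a≡b = a≡b
... | no a≢b = ⊥-elim (<-irrefl refl 2≤1)
  where
  both⇒f : ∀ j → (single a true j ∨ single b true j) ≡ true → f j ≡ true
  both⇒f j eq with j ≟ a | j ≟ b
  ... | yes refl | _ = fa
  ... | no _ | yes refl = fb
  both⇒f j () | no _ | no _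
  2≤1 : 2 ≤ 1
  2≤1 = subst₂ _≤_ (countTrue-single₂ true true a≢b) one (countTrue-mono both⇒f)

countTrue-update : ∀ {m} {f g : Fin m → Bool} a → (∀ j → j ≢ a → f j ≡ g j) →
                   ⟦ f a ⟧ + countTrue g ≡ ⟦ g a ⟧ + countTrue f
countTrue-update {suc m} {f} {g} a agree = begin
  ⟦ f a ⟧ + countTrue g                           ≡⟨ cong (⟦ f a ⟧ +_) (countTrue-remove g a) ⟩
  ⟦ f a ⟧ + (⟦ g a ⟧ + countTrue (g ∘ punchIn a))  ≡⟨ x∙yz≈y∙xz ⟦ f a ⟧ ⟦ g a ⟧ _ ⟩
  ⟦ g a ⟧ + (⟦ f a ⟧ + countTrue (g ∘ punchIn a))  ≡⟨ cong (λ r → ⟦ g a ⟧ + (⟦ f a ⟧ + r)) off-a ⟨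
  ⟦ g a ⟧ + (⟦ f a ⟧ + countTrue (f ∘ punchIn a))  ≡⟨ cong (⟦ g a ⟧ +_) (countTrue-remove f a) ⟨
  ⟦ g a ⟧ + countTrue f                           ∎
  where
  open ≡-Reasoning
  off-a : countTrue (f ∘ punchIn a) ≡ countTrue (g ∘ punchIn a)
  off-a = countTrue-cong (λ k → agree (punchIn a k) (punchInᵢ≢i a k))

Loopless : Graph → Set
Loopless G = ∀ i → adj G i i ≡ false

PerfectMatching : {G : Graph} → SpanningSubgraph G → Set
PerfectMatching S = ∀ u → degreeIn S u ≡ 1

PerfectMatchingThrough : (G : Graph) → Vertex G → Vertex G → Set
PerfectMatchingThrough G i j = Σ (SpanningSubgraph G) λ S → PerfectMatching S × edge S i j ≡ true

perfectMatchingThrough-sym : ∀ {G i j} → PerfectMatchingThrough G i j → PerfectMatchingThrough G j i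
perfectMatchingThrough-sym (S , pm , ij) = S , pm , trans (edgeSym S _ _) ij

HasJoins : Graph → Set
HasJoins G = ∀ v → Σ (SpanningSubgraph G) (IsJoin G v)

EdgesInPerfectMatchings : Graph → Set
EdgesInPerfectMatchings G = ∀ i j → adj G i j ≡ true → PerfectMatchingThrough G i j

isJoin? : ∀ {G} (S : SpanningSubgraph G) v → Dec (IsJoin G v S)
isJoin? S v = (degreeIn S v ℕ.≟ 3) ×-dec all? (λ u → ¬? (u ≟ v) →-dec (degreeIn S u ℕ.≟ 1))

isPerfectMatching? : ∀ {G} (S : SpanningSubgraph G) → Dec (PerfectMatching S)
isPerfectMatching? S = all? (λ u → degreeIn S u ℕ.≟ 1)

module Transport {G H : Graph} (iso : G ≅ H) where

  private
    to : Vertex G → Vertex H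
    to = Inverse.to (proj₁ iso)

    from : Vertex H → Vertex G
    from = Inverse.from (proj₁ iso)

    to-from : ∀ a → to (from a) ≡ a
    to-from = Inverse.strictlyInverseˡ (proj₁ iso)

    from-injective : ∀ {a b} → from a ≡ from b → a ≡ b
    from-injective {a} {b} eq = trans (sym (to-from a)) (trans (cong to eq) (to-from b))

    adj-from : ∀ a b → adj G (from a) (from b) ≡ adj H a b
    adj-from a b = trans (proj₂ iso (from a) (from b)) (cong₂ (adj H) (to-from a) (to-from b))

  subgraph : SpanningSubgraph G → SpanningSubgraph H
  subgraph S = record
    { edge    = λ a b → edge S (from a) (from b)
    ; sub     = λ a b ab → trans (sym (adj-from a b)) (sub S _ _ ab)
    ; edgeSym = λ a b → edgeSym S _ _
    }

  degree-subgraph : ∀ S a → degreeIn (subgraph S) a ≡ degreeIn S (from a)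
  degree-subgraph S a = countTrue-∘↔ (↔-sym (proj₁ iso)) (edge S (from a))

  loopless : Loopless G → Loopless H
  loopless lf a = trans (sym (adj-from a a)) (lf (from a))

  joins : HasJoins G → HasJoins H
  joins J v with J (from v)
  ... | S , deg-v , deg-others =
    subgraph S ,
    trans (degree-subgraph S v) deg-v ,
    λ u u≢v → trans (degree-subgraph S u) (deg-others (from u) (u≢v ∘ from-injective))

  edgesInPerfectMatchings : EdgesInPerfectMatchings G → EdgesInPerfectMatchings H
  edgesInPerfectMatchings M i j ij with M (from i) (from j) (trans (adj-from i j) ij)
  ... | S , pm , S-ij = subgraph S , (λ u → trans (degree-subgraph S u) (pm (from u))) , S-ij

star-edge : Fin 4 → Fin 4 → Fin 4 → Bool
star-edge v a b = not (a == b) ∧ ((a == v) ∨ (b == v))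

star : Fin 4 → SpanningSubgraph K4
star v = record
  { edge    = star-edge v
  ; sub     = λ a b → ∧-conicalˡ _ _
  ; edgeSym = toWitness {a? = all? λ v → all? λ a → all? λ b →
                           star-edge v a b ≟ᴮ star-edge v b a} _ v
  }

-- Matches a with b and the remaining two vertices with each other.
pairing-edge : Fin 4 → Fin 4 → Fin 4 → Fin 4 → Bool
pairing-edge a b x y = not (x == y) ∧ not (side x xor side y)
  where
  side : Fin 4 → Bool
  side z = (z == a) ∨ (z == b)

pairing : Fin 4 → Fin 4 → SpanningSubgraph K4
pairing a b = record
  { edge    = pairing-edge a b
  ; sub     = λ x y → ∧-conicalˡ _ _
  ; edgeSym = toWitness {a? = all? λ a → all? λ b → all? λ x → all? λ y →
                           pairing-edge a b x y ≟ᴮ pairing-edge a b y x} _ a b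
  }

star-isJoin : ∀ v → IsJoin K4 v (star v)
star-isJoin = toWitness {a? = all? λ v → isJoin? (star v) v} _

pairing-through : ∀ a b → adj K4 a b ≡ true →
                  PerfectMatching (pairing a b) × edge (pairing a b) a b ≡ true
pairing-through = toWitness {a? = all? λ a → all? λ b → (adj K4 a b ≟ᴮ true) →-dec
  (isPerfectMatching? (pairing a b) ×-dec (edge (pairing a b) a b ≟ᴮ true))} _

k4-joins : HasJoins K4
k4-joins v = star v , star-isJoin v

k4-edgesInPerfectMatchings : EdgesInPerfectMatchings K4
k4-edgesInPerfectMatchings a b ab = pairing a b , pairing-through a b ab

module Expansion (H : Graph) (w x₁ x₂ x₃ : Vertex H)
                 (nb : NeighboursOf H w x₁ x₂ x₃) (H-loopless : Loopless H) where

  private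
    w~x₁ : adj H w x₁ ≡ true
    w~x₁ = proj₁ (proj₁ nb)
    w~x₂ : adj H w x₂ ≡ true
    w~x₂ = proj₁ (proj₂ (proj₁ nb))
    w~x₃ : adj H w x₃ ≡ true
    w~x₃ = proj₂ (proj₂ (proj₁ nb))
    x₁≢x₂ : x₁ ≢ x₂
    x₁≢x₂ = proj₁ (proj₁ (proj₂ nb))
    x₁≢x₃ : x₁ ≢ x₃
    x₁≢x₃ = proj₁ (proj₂ (proj₁ (proj₂ nb)))
    x₂≢x₃ : x₂ ≢ x₃
    x₂≢x₃ = proj₂ (proj₂ (proj₁ (proj₂ nb)))
    neighbour-of-w : ∀ y → adj H w y ≡ true → y ≡ x₁ ⊎ y ≡ x₂ ⊎ y ≡ x₃
    neighbour-of-w = proj₂ (proj₂ nb)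

    neighbour-≢ : ∀ {x} → adj H w x ≡ true → x ≢ w
    neighbour-≢ w~x refl with () ← trans (sym w~x) (H-loopless _)

    x₁≢w : x₁ ≢ w
    x₁≢w = neighbour-≢ w~x₁
    x₂≢w : x₂ ≢ w
    x₂≢w = neighbour-≢ w~x₂
    x₃≢w : x₃ ≢ w
    x₃≢w = neighbour-≢ w~x₃

  G′ : Graph
  G′ = replace H w x₁ x₂ x₃

  v₁ v₂ v₃ : Vertex G′
  v₁ = suc (suc w)
  v₂ = zero
  v₃ = suc zero

  old : Vertex H → Vertex G′
  old u = suc (suc u)

  contract : Vertex G′ → Vertex H
  contract zero = w
  contract (suc zero) = w
  contract (suc (suc u)) = u

  contract-≡ : ∀ {v} a → v ≢ w → contract a ≡ v → a ≡ old v
  contract-≡ zero v≢w refl = ⊥-elim (v≢w refl)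
  contract-≡ (suc zero) v≢w refl = ⊥-elim (v≢w refl)
  contract-≡ (suc (suc u)) _ refl = refl

  vertex-cases : (P : Vertex G′ → Set) → P v₁ → P v₂ → P v₃ → (∀ u → u ≢ w → P (old u)) → ∀ a → P a
  vertex-cases P p₁ p₂ p₃ p-old zero = p₂
  vertex-cases P p₁ p₂ p₃ p-old (suc zero) = p₃
  vertex-cases P p₁ p₂ p₃ p-old (suc (suc u)) with u ≟ w
  ... | yes refl = p₁
  ... | no u≢w = p-old u u≢w

  loopless : Loopless G′
  loopless zero = refl
  loopless (suc zero) = refl
  loopless (suc (suc i)) with i ≟ w
  ... | yes refl = ≢⇒==-false (x₁≢w ∘ sym)
  ... | no _ = H-loopless i

  spoke₁ spoke₂ spoke₃ : SpanningSubgraph H → Vertex H → Bool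
  spoke₁ S = single x₁ (edge S w x₁)
  spoke₂ S = single x₂ (edge S w x₂)
  spoke₃ S = single x₃ (edge S w x₃)

  edge-at-w : ∀ S u → edge S w u ≡ spoke₁ S u ∨ (spoke₂ S u ∨ spoke₃ S u)
  edge-at-w S u with u ≟ x₁ | u ≟ x₂ | u ≟ x₃
  ... | yes refl | yes x₁≡x₂ | _ = ⊥-elim (x₁≢x₂ x₁≡x₂)
  ... | yes refl | no _ | yes x₁≡x₃ = ⊥-elim (x₁≢x₃ x₁≡x₃)
  ... | no _ | yes refl | yes x₂≡x₃ = ⊥-elim (x₂≢x₃ x₂≡x₃)
  ... | yes refl | no _ | no _ = sym (∨-identityʳ _)
  ... | no _ | yes refl | no _ = sym (∨-identityʳ _)
  ... | no _ | no _ | yes refl = refl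
  ... | no u≢x₁ | no u≢x₂ | no u≢x₃ = ¬-not not-neighbour
    where
    not-neighbour : edge S w u ≢ true
    not-neighbour w-u with neighbour-of-w u (sub S w u w-u)
    ... | inj₁ u≡x₁ = u≢x₁ u≡x₁
    ... | inj₂ (inj₁ u≡x₂) = u≢x₂ u≡x₂
    ... | inj₂ (inj₂ u≡x₃) = u≢x₃ u≡x₃

  private
    spokes-disjoint : ∀ {p q r} u → single x₁ p u ≡ true → (single x₂ q u ∨ single x₃ r u) ≡ false
    spokes-disjoint u x₁-u = cong₂ _∨_ (single-disjoint u x₁≢x₂ x₁-u) (single-disjoint u x₁≢x₃ x₁-u)

  degree-w : ∀ S → degreeIn S w ≡ ⟦ edge S w x₁ ⟧ + (⟦ edge S w x₂ ⟧ + ⟦ edge S w x₃ ⟧)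
  degree-w S = begin
    countTrue (edge S w)
      ≡⟨ countTrue-cong (edge-at-w S) ⟩
    countTrue (λ u → spoke₁ S u ∨ (spoke₂ S u ∨ spoke₃ S u))
      ≡⟨ countTrue-∨ spokes-disjoint ⟩
    countTrue (spoke₁ S) + countTrue (λ u → spoke₂ S u ∨ spoke₃ S u)
      ≡⟨ cong₂ _+_ (countTrue-single x₁ _) (countTrue-single₂ _ _ x₂≢x₃) ⟩
    ⟦ edge S w x₁ ⟧ + (⟦ edge S w x₂ ⟧ + ⟦ edge S w x₃ ⟧)
      ∎
    where open ≡-Reasoning

  ⟦edge-to-w⟧ : ∀ S u → ⟦ edge S u w ⟧ ≡ ⟦ spoke₁ S u ⟧ + (⟦ spoke₂ S u ⟧ + ⟦ spoke₃ S u ⟧)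
  ⟦edge-to-w⟧ S u = begin
    ⟦ edge S u w ⟧
      ≡⟨ cong ⟦_⟧ (trans (edgeSym S u w) (edge-at-w S u)) ⟩
    ⟦ spoke₁ S u ∨ (spoke₂ S u ∨ spoke₃ S u) ⟧
      ≡⟨ ⟦∨⟧ (spokes-disjoint u) ⟩
    ⟦ spoke₁ S u ⟧ + ⟦ spoke₂ S u ∨ spoke₃ S u ⟧
      ≡⟨ cong (⟦ spoke₁ S u ⟧ +_) (⟦∨⟧ (single-disjoint u x₂≢x₃)) ⟩
    ⟦ spoke₁ S u ⟧ + (⟦ spoke₂ S u ⟧ + ⟦ spoke₃ S u ⟧)
      ∎
    where open ≡-Reasoning

  -- S lifted to G′: edges of S not at w are kept, the edge w xᵢ becomes vᵢ xᵢ,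
  -- and tᵢⱼ says whether the triangle edge vᵢ vⱼ is taken.
  module Lift (S : SpanningSubgraph H) (t₁₂ t₂₃ t₁₃ : Bool) where

    lift-edge : Vertex G′ → Vertex G′ → Bool
    lift-edge zero zero = false
    lift-edge zero (suc zero) = t₂₃
    lift-edge (suc zero) zero = t₂₃
    lift-edge (suc zero) (suc zero) = false
    lift-edge zero (suc (suc j)) = single w t₁₂ j ∨ spoke₂ S j
    lift-edge (suc (suc i)) zero = single w t₁₂ i ∨ spoke₂ S i
    lift-edge (suc zero) (suc (suc j)) = single w t₁₃ j ∨ spoke₃ S j
    lift-edge (suc (suc i)) (suc zero) = single w t₁₃ i ∨ spoke₃ S i
    lift-edge (suc (suc i)) (suc (suc j)) =
      if i == w then spoke₁ S j else if j == w then spoke₁ S i else edge S i j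

    private
      lift-sub : ∀ a b → lift-edge a b ≡ true → adj G′ a b ≡ true
      lift-sub zero zero ()
      lift-sub zero (suc zero) _ = refl
      lift-sub (suc zero) zero _ = refl
      lift-sub (suc zero) (suc zero) ()
      lift-sub zero (suc (suc j)) = ∨-∧-conicalˡ (j == w) t₁₂ (j == x₂) _
      lift-sub (suc (suc i)) zero = ∨-∧-conicalˡ (i == w) t₁₂ (i == x₂) _
      lift-sub (suc zero) (suc (suc j)) = ∨-∧-conicalˡ (j == w) t₁₃ (j == x₃) _
      lift-sub (suc (suc i)) (suc zero) = ∨-∧-conicalˡ (i == w) t₁₃ (i == x₃) _
      lift-sub (suc (suc i)) (suc (suc j)) with i == w | j == w
      ... | true | _ = ∧-conicalˡ _ _
      ... | false | true = ∧-conicalˡ _ _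
      ... | false | false = sub S i j

      lift-sym : ∀ a b → lift-edge a b ≡ lift-edge b a
      lift-sym zero zero = refl
      lift-sym zero (suc zero) = refl
      lift-sym (suc zero) zero = refl
      lift-sym (suc zero) (suc zero) = refl
      lift-sym zero (suc (suc j)) = refl
      lift-sym (suc (suc i)) zero = refl
      lift-sym (suc zero) (suc (suc j)) = refl
      lift-sym (suc (suc i)) (suc zero) = refl
      lift-sym (suc (suc i)) (suc (suc j)) with i ≟ w | j ≟ w
      ... | yes refl | yes refl = refl
      ... | yes refl | no _ = refl
      ... | no _ | yes refl = refl
      ... | no _ | no _ = edgeSym S i j

    lift : SpanningSubgraph G′
    lift = record { edge = lift-edge ; sub = lift-sub ; edgeSym = lift-sym }

    lift-old-old : ∀ {i j} → i ≢ w → j ≢ w → lift-edge (old i) (old j) ≡ edge S i j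
    lift-old-old i≢w j≢w rewrite ≢⇒==-false i≢w | ≢⇒==-false j≢w = refl

    lift-v₁-old : ∀ j → lift-edge v₁ (old j) ≡ spoke₁ S j
    lift-v₁-old j rewrite ==-refl w = refl

    lift-v₁-x₁ : lift-edge v₁ (old x₁) ≡ edge S w x₁
    lift-v₁-x₁ = trans (lift-v₁-old x₁) (single-here x₁ _)

    lift-v₂-x₂ : lift-edge v₂ (old x₂) ≡ edge S w x₂
    lift-v₂-x₂ = cong₂ _∨_ (single-elsewhere t₁₂ x₂≢w) (single-here x₂ _)

    lift-v₃-x₃ : lift-edge v₃ (old x₃) ≡ edge S w x₃
    lift-v₃-x₃ = cong₂ _∨_ (single-elsewhere t₁₃ x₃≢w) (single-here x₃ _)

    lift-v₁-v₂ : lift-edge v₁ v₂ ≡ t₁₂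
    lift-v₁-v₂ = trans (cong₂ _∨_ (single-here w t₁₂) (single-elsewhere _ (x₂≢w ∘ sym)))
                       (∨-identityʳ t₁₂)

    lift-v₁-v₃ : lift-edge v₁ v₃ ≡ t₁₃
    lift-v₁-v₃ = trans (cong₂ _∨_ (single-here w t₁₃) (single-elsewhere _ (x₃≢w ∘ sym)))
                       (∨-identityʳ t₁₃)

    private
      degree-split : ∀ a → degreeIn lift a ≡
                     ⟦ lift-edge a v₂ ⟧ + (⟦ lift-edge a v₃ ⟧ + countTrue (lift-edge a ∘ old))
      degree-split a = trans (countTrue-suc (lift-edge a))
                             (cong (⟦ lift-edge a v₂ ⟧ +_) (countTrue-suc (lift-edge a ∘ suc)))

    degree-v₁ : degreeIn lift v₁ ≡ ⟦ t₁₂ ⟧ + (⟦ t₁₃ ⟧ + ⟦ edge S w x₁ ⟧)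
    degree-v₁ = begin
      degreeIn lift v₁
        ≡⟨ degree-split v₁ ⟩
      ⟦ lift-edge v₁ v₂ ⟧ + (⟦ lift-edge v₁ v₃ ⟧ + countTrue (lift-edge v₁ ∘ old))
        ≡⟨ cong₂ (λ p q → ⟦ p ⟧ + (⟦ q ⟧ + countTrue (lift-edge v₁ ∘ old))) lift-v₁-v₂ lift-v₁-v₃ ⟩
      ⟦ t₁₂ ⟧ + (⟦ t₁₃ ⟧ + countTrue (lift-edge v₁ ∘ old))
        ≡⟨ cong (λ d → ⟦ t₁₂ ⟧ + (⟦ t₁₃ ⟧ + d)) (countTrue-cong lift-v₁-old) ⟩
      ⟦ t₁₂ ⟧ + (⟦ t₁₃ ⟧ + countTrue (spoke₁ S))
        ≡⟨ cong (λ d → ⟦ t₁₂ ⟧ + (⟦ t₁₃ ⟧ + d)) (countTrue-single x₁ _) ⟩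
      ⟦ t₁₂ ⟧ + (⟦ t₁₃ ⟧ + ⟦ edge S w x₁ ⟧)
        ∎
      where open ≡-Reasoning

    degree-v₂ : degreeIn lift v₂ ≡ ⟦ t₂₃ ⟧ + (⟦ t₁₂ ⟧ + ⟦ edge S w x₂ ⟧)
    degree-v₂ = trans (degree-split v₂) (cong (⟦ t₂₃ ⟧ +_) (countTrue-single₂ t₁₂ _ (x₂≢w ∘ sym)))

    degree-v₃ : degreeIn lift v₃ ≡ ⟦ t₂₃ ⟧ + (⟦ t₁₃ ⟧ + ⟦ edge S w x₃ ⟧)
    degree-v₃ = trans (degree-split v₃) (cong (⟦ t₂₃ ⟧ +_) (countTrue-single₂ t₁₃ _ (x₃≢w ∘ sym)))

    -- The edge u w of S reappears as exactly one of the edges from old u to v₁, v₂, v₃.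
    degree-old : ∀ {u} → u ≢ w → degreeIn lift (old u) ≡ degreeIn S u
    degree-old {u} u≢w = +-cancelˡ-≡ ⟦ s₁ ⟧ _ _ (begin
      ⟦ s₁ ⟧ + degreeIn lift (old u)                   ≡⟨ cong (⟦ s₁ ⟧ +_) (degree-split (old u)) ⟩
      ⟦ s₁ ⟧ + (⟦ row v₂ ⟧ + (⟦ row v₃ ⟧ + countTrue (row ∘ old)))
        ≡⟨ cong₂ (λ p q → ⟦ s₁ ⟧ + (⟦ p ⟧ + (⟦ q ⟧ + countTrue (row ∘ old)))) row-v₂ row-v₃ ⟩
      ⟦ s₁ ⟧ + (⟦ s₂ ⟧ + (⟦ s₃ ⟧ + countTrue (row ∘ old)))
        ≡⟨ cong (⟦ s₁ ⟧ +_) (+-assoc ⟦ s₂ ⟧ ⟦ s₃ ⟧ _) ⟨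
      ⟦ s₁ ⟧ + ((⟦ s₂ ⟧ + ⟦ s₃ ⟧) + countTrue (row ∘ old))
        ≡⟨ +-assoc ⟦ s₁ ⟧ _ _ ⟨
      (⟦ s₁ ⟧ + (⟦ s₂ ⟧ + ⟦ s₃ ⟧)) + countTrue (row ∘ old)
        ≡⟨ cong (_+ countTrue (row ∘ old)) (⟦edge-to-w⟧ S u) ⟨
      ⟦ edge S u w ⟧ + countTrue (row ∘ old)
        ≡⟨ countTrue-update w row-off-w ⟩
      ⟦ row (old w) ⟧ + degreeIn S u
        ≡⟨ cong (λ p → ⟦ p ⟧ + degreeIn S u) row-v₁ ⟩
      ⟦ s₁ ⟧ + degreeIn S u                            ∎)
      where
      open ≡-Reasoning
      row : Vertex G′ → Bool
      row = lift-edge (old u)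
      s₁ s₂ s₃ : Bool
      s₁ = spoke₁ S u
      s₂ = spoke₂ S u
      s₃ = spoke₃ S u
      row-v₁ : row v₁ ≡ s₁
      row-v₁ rewrite ≢⇒==-false u≢w | ==-refl w = refl
      row-v₂ : row v₂ ≡ s₂
      row-v₂ rewrite ≢⇒==-false u≢w = refl
      row-v₃ : row v₃ ≡ s₃
      row-v₃ rewrite ≢⇒==-false u≢w = refl
      row-off-w : ∀ j → j ≢ w → edge S u j ≡ row (old j)
      row-off-w j j≢w = sym (lift-old-old u≢w j≢w)

  open Lift public

  module Matched (S : SpanningSubgraph H) = Lift S (edge S w x₃) (edge S w x₁) (edge S w x₂)

  matched-lift : SpanningSubgraph H → SpanningSubgraph G′
  matched-lift S = Matched.lift S

  degree-matched-lift : ∀ S a → degreeIn (matched-lift S) a ≡ degreeIn S (contract a)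
  degree-matched-lift S = vertex-cases (λ a → degreeIn (matched-lift S) a ≡ degreeIn S (contract a))
    (trans (Matched.degree-v₁ S) (trans (x∙yz≈z∙yx ⟦ e₃ ⟧ ⟦ e₂ ⟧ ⟦ e₁ ⟧) (sym (degree-w S))))
    (trans (Matched.degree-v₂ S) (trans (x∙yz≈x∙zy ⟦ e₁ ⟧ ⟦ e₃ ⟧ ⟦ e₂ ⟧) (sym (degree-w S))))
    (trans (Matched.degree-v₃ S) (sym (degree-w S)))
    (λ u → Matched.degree-old S)
    where
    e₁ e₂ e₃ : Bool
    e₁ = edge S w x₁
    e₂ = edge S w x₂
    e₃ = edge S w x₃

  matched-lift-perfect : ∀ {S} → PerfectMatching S → PerfectMatching (matched-lift S)
  matched-lift-perfect {S} pm a = trans (degree-matched-lift S a) (pm (contract a))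

  through-matched-lift : ∀ {i j a b} → (∀ S → edge (matched-lift S) a b ≡ edge S i j) →
                         PerfectMatchingThrough H i j → PerfectMatchingThrough G′ a b
  through-matched-lift lift-ab (S , pm , S-ij) =
    matched-lift S , matched-lift-perfect pm , trans (lift-ab S) S-ij

  join-old : ∀ {v} → v ≢ w → Σ (SpanningSubgraph H) (IsJoin H v) →
             Σ (SpanningSubgraph G′) (IsJoin G′ (old v))
  join-old {v} v≢w (S , deg-v , deg-others) =
    matched-lift S ,
    trans (degree-matched-lift S (old v)) deg-v ,
    λ a a≢v → trans (degree-matched-lift S a) (deg-others (contract a) (a≢v ∘ contract-≡ a v≢w))

  private
    unmatched : ∀ (S : SpanningSubgraph H) {x y} → PerfectMatching S →
                edge S w x ≡ true → x ≢ y → edge S w y ≡ false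
    unmatched S pm w-x x≢y = ¬-not (λ w-y → x≢y (countTrue≡1-unique (pm w) w-x w-y))

    join-lift : ∀ {S} t₁₂ t₂₃ t₁₃ v → PerfectMatching S →
                degreeIn (lift S t₁₂ t₂₃ t₁₃) v ≡ 3 →
                (v₁ ≢ v → degreeIn (lift S t₁₂ t₂₃ t₁₃) v₁ ≡ 1) →
                (v₂ ≢ v → degreeIn (lift S t₁₂ t₂₃ t₁₃) v₂ ≡ 1) →
                (v₃ ≢ v → degreeIn (lift S t₁₂ t₂₃ t₁₃) v₃ ≡ 1) →
                Σ (SpanningSubgraph G′) (IsJoin G′ v)
    join-lift {S} t₁₂ t₂₃ t₁₃ v pm deg-v deg₁ deg₂ deg₃ =
      lift S t₁₂ t₂₃ t₁₃ , deg-v ,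
      vertex-cases (λ a → a ≢ v → degreeIn (lift S t₁₂ t₂₃ t₁₃) a ≡ 1) deg₁ deg₂ deg₃
        (λ u u≢w _ → trans (degree-old S t₁₂ t₂₃ t₁₃ u≢w) (pm u))

  join-v₁ : PerfectMatchingThrough H w x₁ → Σ (SpanningSubgraph G′) (IsJoin G′ v₁)
  join-v₁ (S , pm , w-x₁) = join-lift true false true v₁ pm
    (trans (degree-v₁ S _ _ _) (cong (λ e → 2 + ⟦ e ⟧) w-x₁))
    (λ v₁≢v₁ → ⊥-elim (v₁≢v₁ refl))
    (λ _ → trans (degree-v₂ S _ _ _) (cong (λ e → 1 + ⟦ e ⟧) (unmatched S pm w-x₁ x₁≢x₂)))
    (λ _ → trans (degree-v₃ S _ _ _) (cong (λ e → 1 + ⟦ e ⟧) (unmatched S pm w-x₁ x₁≢x₃)))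

  join-v₂ : PerfectMatchingThrough H w x₂ → Σ (SpanningSubgraph G′) (IsJoin G′ v₂)
  join-v₂ (S , pm , w-x₂) = join-lift true true false v₂ pm
    (trans (degree-v₂ S _ _ _) (cong (λ e → 2 + ⟦ e ⟧) w-x₂))
    (λ _ → trans (degree-v₁ S _ _ _) (cong (λ e → 1 + ⟦ e ⟧) (unmatched S pm w-x₂ (x₁≢x₂ ∘ sym))))
    (λ v₂≢v₂ → ⊥-elim (v₂≢v₂ refl))
    (λ _ → trans (degree-v₃ S _ _ _) (cong (λ e → 1 + ⟦ e ⟧) (unmatched S pm w-x₂ x₂≢x₃)))

  join-v₃ : PerfectMatchingThrough H w x₃ → Σ (SpanningSubgraph G′) (IsJoin G′ v₃)
  join-v₃ (S , pm , w-x₃) = join-lift false true true v₃ pm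
    (trans (degree-v₃ S _ _ _) (cong (λ e → 2 + ⟦ e ⟧) w-x₃))
    (λ _ → trans (degree-v₁ S _ _ _) (cong (λ e → 1 + ⟦ e ⟧) (unmatched S pm w-x₃ (x₁≢x₃ ∘ sym))))
    (λ _ → trans (degree-v₂ S _ _ _) (cong (λ e → 1 + ⟦ e ⟧) (unmatched S pm w-x₃ (x₂≢x₃ ∘ sym))))
    (λ v₃≢v₃ → ⊥-elim (v₃≢v₃ refl))

  joins : HasJoins H → EdgesInPerfectMatchings H → HasJoins G′
  joins J M = vertex-cases (λ v → Σ (SpanningSubgraph G′) (IsJoin G′ v))
    (join-v₁ (M w x₁ w~x₁)) (join-v₂ (M w x₂ w~x₂)) (join-v₃ (M w x₃ w~x₃))
    (λ v v≢w → join-old v≢w (J v))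

  edgesInPerfectMatchings : EdgesInPerfectMatchings H → EdgesInPerfectMatchings G′
  edgesInPerfectMatchings M = through
    where
    via-x₁ : PerfectMatchingThrough H w x₁
    via-x₁ = M w x₁ w~x₁
    via-x₂ : PerfectMatchingThrough H w x₂
    via-x₂ = M w x₂ w~x₂
    via-x₃ : PerfectMatchingThrough H w x₃
    via-x₃ = M w x₃ w~x₃


    v₂-v₃ : PerfectMatchingThrough G′ v₂ v₃
    v₂-v₃ = through-matched-lift (λ S → refl) via-x₁
    v₁-v₃ : PerfectMatchingThrough G′ v₁ v₃
    v₁-v₃ = through-matched-lift Matched.lift-v₁-v₃ via-x₂
    v₁-v₂ : PerfectMatchingThrough G′ v₁ v₂
    v₁-v₂ = through-matched-lift Matched.lift-v₁-v₂ via-x₃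
    v₁-x₁ : PerfectMatchingThrough G′ v₁ (old x₁)
    v₁-x₁ = through-matched-lift Matched.lift-v₁-x₁ via-x₁
    v₂-x₂ : PerfectMatchingThrough G′ v₂ (old x₂)
    v₂-x₂ = through-matched-lift Matched.lift-v₂-x₂ via-x₂
    v₃-x₃ : PerfectMatchingThrough G′ v₃ (old x₃)
    v₃-x₃ = through-matched-lift Matched.lift-v₃-x₃ via-x₃

    from-v₂ : ∀ j → adj G′ v₂ (old j) ≡ true → PerfectMatchingThrough G′ v₂ (old j)
    from-v₂ j v₂~j with j ≟ w | j ≟ x₂
    ... | yes refl | _ = perfectMatchingThrough-sym v₁-v₂
    ... | no _ | yes refl = v₂-x₂
    from-v₂ j () | no _ | no _

    from-v₃ : ∀ j → adj G′ v₃ (old j) ≡ true → PerfectMatchingThrough G′ v₃ (old j)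
    from-v₃ j v₃~j with j ≟ w | j ≟ x₃
    ... | yes refl | _ = perfectMatchingThrough-sym v₁-v₃
    ... | no _ | yes refl = v₃-x₃
    from-v₃ j () | no _ | no _

    from-old : ∀ i j → adj G′ (old i) (old j) ≡ true → PerfectMatchingThrough G′ (old i) (old j)
    from-old i j i~j with i ≟ w | j ≟ w
    ... | yes refl | _ rewrite ==⇒≡ {i = j} i~j = v₁-x₁
    ... | no _ | yes refl rewrite ==⇒≡ {i = i} i~j = perfectMatchingThrough-sym v₁-x₁
    ... | no i≢w | no j≢w = through-matched-lift (λ S → Matched.lift-old-old S i≢w j≢w) (M i j i~j)

    through : EdgesInPerfectMatchings G′
    through zero zero ()
    through zero (suc zero) _ = v₂-v₃
    through (suc zero) zero _ = perfectMatchingThrough-sym v₂-v₃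
    through (suc zero) (suc zero) ()
    through zero (suc (suc j)) = from-v₂ j
    through (suc (suc i)) zero i~v₂ = perfectMatchingThrough-sym (from-v₂ i i~v₂)
    through (suc zero) (suc (suc j)) = from-v₃ j
    through (suc (suc i)) (suc zero) i~v₃ = perfectMatchingThrough-sym (from-v₃ i i~v₃)
    through (suc (suc i)) (suc (suc j)) = from-old i j

klee-loopless : ∀ {G} → IsKlee G → Loopless G
klee-loopless k4 i = cong not (==-refl i)
klee-loopless (expand {H} k w x₁ x₂ x₃ nb) = Expansion.loopless H w x₁ x₂ x₃ nb (klee-loopless k)
klee-loopless (isoKlee {G} {H} k iso) = Transport.loopless {G} {H} iso (klee-loopless k)

klee-joins-and-matchings : ∀ {G} → IsKlee G → HasJoins G × EdgesInPerfectMatchings G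
klee-joins-and-matchings k4 = k4-joins , k4-edgesInPerfectMatchings
klee-joins-and-matchings (expand {H} k w x₁ x₂ x₃ nb) with klee-joins-and-matchings k
... | J , M = joins J M , edgesInPerfectMatchings M
  where open Expansion H w x₁ x₂ x₃ nb (klee-loopless k)
klee-joins-and-matchings (isoKlee {G} {H} k iso) with klee-joins-and-matchings k
... | J , M = joins J , edgesInPerfectMatchings M
  where open Transport {G} {H} iso

lemma7 : (G : Graph) → IsKlee G → (v : Vertex G) →
         Σ (SpanningSubgraph G) (IsJoin G v)
lemma7 G k = proj₁ (klee-joins-and-matchings k)
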